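{- Let $a$, $b$, $d$ be positive integers with $d$ not a perfect square, put $\alpha=a+b^{2}\sqrt{d}$ and $N_{\alpha}=a^{2}-b^{4}d$, and suppose $N_{\alpha}<0$. Let $\varepsilon=(t+u\sqrt{d})/2$ be a unit in the ring of integers of $\mathbb{Q}(\sqrt{d})$ with $t,u$ positive integers, and let $N_{\varepsilon}=\pm1$ be its norm. Define $(x_k)_{k\in\mathbb{Z}}$, $(y_k)_{k\in\mathbb{Z}}$ by $x_k+y_k\sqrt{d}=\alpha\varepsilon^{2k}$. Assume that $\alpha$ is chosen so that $y_0=b^{2}$ is the smallest square among the $y_k$'s, and let $K$ be the largest negative integer such that $y_K>b^{2}$. (a) For all $k$, $2y_k$ is a positive integer. The sequences $(y_k)_{k\geq0}$ and $(y_{K+1},y_K,y_{K-1},y_{K-2},\ldots)$ are increasing sequences of positive numbers. (b) We have \[ y_k\geq \begin{cases} \dfrac{|N_{\alpha}|u^{2}}{4b^{2}}\,(du^{2}-3)^{k-1} & \text{for } k>0,\\[2mm] \dfrac{|N_{\alpha}|u^{2}}{4b^{2}}\,(du^{2}-3)^{\max(0,K-k)} & \text{for } k<0.\end{cases} \] (c) If $N_{\varepsilon}=1$ or $du^{2}\geq 300$, then \[ y_k\geq \begin{cases} \dfrac{|N_{\alpha}|u^{2}}{4b^{2}}\,(0.99\,du^{2})^{k-1} & \text{for } k>0,\\[2mm] \dfrac{|N_{\alpha}|u^{2}}{4b^{2}}\,(0.99\,du^{2})^{\max(0,K-k)} & \text{for } k<0.\end{cases} \] For any $d>1$, these inequalities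 hold with $0.99$ replaced by $0.4$.
   Context: "Square" means the square of an integer. -}

module Defs where

open import Data.Nat as ℕ using (ℕ; zero; suc; NonZero)
open import Data.Nat.Properties using (m*n≢0)
open import Data.Integer as ℤ using (ℤ; +_; 0ℤ; 1ℤ)
open import Data.Rational as ℚ using (ℚ; _/_; 1ℚ)
open import Data.Product using (_×_; _,_; ∃-syntax)
open import Relation.Binary.PropositionalEquality using (_≡_)

ℚz : ℤ → ℚ
ℚz z = z / 1

ℚn : ℕ → ℚ
ℚn n = + n / 1

_^ℚ_ : ℚ → ℕ → ℚ
q ^ℚ zero  = 1ℚ
q ^ℚ suc n = q ℚ.* (q ^ℚ n)

-- elements x + y √d of Q(√d), represented as pairs (x , y) of rationals
QD : Set
QD = ℚ × ℚ

-- multiplication in Q(√d):  (x + y√d)(p + q√d) = (xp + d y q) + (xq + yp)√d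
mulD : ℕ → QD → QD → QD
mulD d (x , y) (p , q) = (x ℚ.* p ℚ.+ ℚn d ℚ.* y ℚ.* q , x ℚ.* q ℚ.+ y ℚ.* p)

epsD : ℕ → ℕ → QD
epsD t u = (+ t / 2 , + u / 2)

normEps : ℕ → ℕ → ℕ → ℚ
normEps d t u = (+ (t ℕ.* t) ℤ.- + (d ℕ.* u ℕ.* u)) / 4

IsSquareℚ : ℚ → Set
IsSquareℚ q = ∃[ m ] (q ≡ ℚz (m ℤ.* m))

Nalpha : ℕ → ℕ → ℕ → ℤ
Nalpha a b d = + (a ℕ.* a) ℤ.- + (b ℕ.* b ℕ.* b ℕ.* b ℕ.* d)

coef : (a b d u : ℕ) → .{{NonZero b}} → ℚ
coef a b d u {{nz}} =
  _/_ (+ (ℤ.∣ Nalpha a b d ∣ ℕ.* u ℕ.* u)) (4 ℕ.* b ℕ.* b) {{m*n≢0 (4 ℕ.* b) b {{m*n≢0 4 b {{_}} {{nz}}}} {{nz}}}}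

LowerBounds : (C r : ℚ) (K : ℤ) (y : ℤ → ℚ) → Set
LowerBounds C r K y =
  (∀ k → 0ℤ ℤ.< k → C ℚ.* (r ^ℚ ℤ.∣ k ℤ.- 1ℤ ∣) ℚ.≤ y k) ×
  (∀ k → k ℤ.< 0ℤ → C ℚ.* (r ^ℚ ℤ.∣ (K ℤ.- k) ℤ.⊔ 0ℤ ∣) ℚ.≤ y k)

{-# OPTIONS --safe #-}
module Submission where

open import Defs
open import Data.Nat as ℕ using (ℕ; NonZero)
open import Data.Integer as ℤ using (ℤ; +_; 0ℤ; 1ℤ)
open import Data.Rational as ℚ using (ℚ; _/_; 1ℚ)
open import Data.Product using (_×_; _,_; ∃-syntax)
open import Data.Sum using (_⊎_)
open import Relation.Binary.PropositionalEquality using (_≡_; _≢_)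

open import Algebra.Bundles using (CommutativeMonoid)
open import Data.Empty using (⊥-elim)
open import Data.Integer using (-[1+_])
import Data.Integer.Properties as ℤP
import Data.Integer.Tactic.RingSolver as ℤ-Solver
open import Data.List using (_∷_; [])
open import Data.Nat using (zero; suc; z≤n; s≤s)
import Data.Nat.Properties as ℕP
open import Data.Product using (proj₁; proj₂)
open import Data.Rational using (0ℚ; _+_; _*_; _-_; -_; _≤_; _<_; toℚᵘ)
import Data.Rational.Properties as ℚP
open import Data.Rational.Solver using (module +-*-Solver)
open import Data.Rational.Unnormalised as ℚᵘ using (ℚᵘ; mkℚᵘ; *≡*; *≤*; *<*)
import Data.Rational.Unnormalised.Properties as ℚᵘP
open import Data.Sum using (inj₁; inj₂)
open import Function using (_∘_)
open import Level using (0ℓ)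
open import Relation.Binary.PropositionalEquality
open import Relation.Nullary.Decidable using (dec⇒maybe)
open import Tactic.RingSolver using (solve-∀; solve)
open import Tactic.RingSolver.Core.AlmostCommutativeRing using (AlmostCommutativeRing; fromCommutativeRing)

open import Algebra.Properties.CommutativeSemigroup
  (CommutativeMonoid.commutativeSemigroup ℚP.*-1-commutativeMonoid) using (x∙yz≈y∙xz)

-- Write ε̄ = (t − u√d)/2 and N = N_ε = ±1. As (εε̄)² = N² = 1, stepping from k to k − 1 is
-- multiplication by ε̄², so (x_k, y_k) is α(ε^k)² for k ≥ 0 and α(ε̄^−k)² for k ≤ 0, and
-- y_{k+1} + y_{k−1} = T y_k with T = tr ε² = du² + 2N an integer.
--
-- For η = p + r√d the second coordinate y of αη² satisfies b² y = (b² p + a r)² + |N_α| r², and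
-- every ε^m, ε̄^m with m ≥ 1 has |r| ≥ u/2; so y_k ≥ C = |N_α| u²/(4b²) for k ≠ 0.
--
-- From t² − du² = ±4 one gets du² ≥ 5, hence T ≥ 2. A sequence with y_{k+1} + y_{k−1} = T y_k
-- that increases once keeps increasing, with y_{k+1} ≥ (T − 1) y_k. Read forwards from y₀ < y₁
-- and backwards from y_{K+1} ≤ b² < y_K this gives (a), and (b), (c) because T − 1, which is
-- du² + 1 or du² − 3, dominates each of the ratios. Integrality of 2y_k follows from the
-- recurrence, since 2y₀ = 2b² and 2y₁ = b² T + a t u.

ℚ-ring : AlmostCommutativeRing 0ℓ 0ℓ
ℚ-ring = fromCommutativeRing ℚP.+-*-commutativeRing (λ q → dec⇒maybe (0ℚ ℚP.≟ q))

private
  ι : ℤ → ℚᵘ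
  ι i = mkℚᵘ i 0

  toℚᵘ-ℚz : ∀ i → toℚᵘ (ℚz i) ℚᵘ.≃ ι i
  toℚᵘ-ℚz i = ℚP.toℚᵘ-fromℚᵘ (ι i)

ℚz-homo-+ : ∀ i j → ℚz (i ℤ.+ j) ≡ ℚz i + ℚz j
ℚz-homo-+ i j = ℚP.toℚᵘ-injective (begin
  toℚᵘ (ℚz (i ℤ.+ j))           ≈⟨ toℚᵘ-ℚz (i ℤ.+ j) ⟩
  ι (i ℤ.+ j)                   ≈⟨ *≡* (cong (ℤ._* 1ℤ) (cong₂ ℤ._+_ (sym (ℤP.*-identityʳ i))
                                                                   (sym (ℤP.*-identityʳ j)))) ⟩
  ι i ℚᵘ.+ ι j                  ≈⟨ ℚᵘP.+-cong (toℚᵘ-ℚz i) (toℚᵘ-ℚz j) ⟨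
  toℚᵘ (ℚz i) ℚᵘ.+ toℚᵘ (ℚz j)  ≈⟨ ℚP.toℚᵘ-homo-+ (ℚz i) (ℚz j) ⟨
  toℚᵘ (ℚz i + ℚz j)            ∎)
  where open ℚᵘP.≃-Reasoning

ℚz-homo-* : ∀ i j → ℚz (i ℤ.* j) ≡ ℚz i * ℚz j
ℚz-homo-* i j = ℚP.toℚᵘ-injective (begin
  toℚᵘ (ℚz (i ℤ.* j))           ≈⟨ toℚᵘ-ℚz (i ℤ.* j) ⟩
  ι i ℚᵘ.* ι j                  ≈⟨ ℚᵘP.*-cong (toℚᵘ-ℚz i) (toℚᵘ-ℚz j) ⟨
  toℚᵘ (ℚz i) ℚᵘ.* toℚᵘ (ℚz j)  ≈⟨ ℚP.toℚᵘ-homo-* (ℚz i) (ℚz j) ⟨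
  toℚᵘ (ℚz i * ℚz j)            ∎)
  where open ℚᵘP.≃-Reasoning

ℚz-homo‿- : ∀ i → ℚz (ℤ.- i) ≡ - ℚz i
ℚz-homo‿- i = ℚP.toℚᵘ-injective (begin
  toℚᵘ (ℚz (ℤ.- i))  ≈⟨ toℚᵘ-ℚz (ℤ.- i) ⟩
  ℚᵘ.- ι i           ≈⟨ ℚᵘP.-‿cong (toℚᵘ-ℚz i) ⟨
  ℚᵘ.- toℚᵘ (ℚz i)   ≈⟨ ℚP.toℚᵘ-homo‿- (ℚz i) ⟨
  toℚᵘ (- ℚz i)      ∎)
  where open ℚᵘP.≃-Reasoning

ℚz-homo-- : ∀ i j → ℚz (i ℤ.- j) ≡ ℚz i - ℚz j
ℚz-homo-- i j = trans (ℚz-homo-+ i (ℤ.- j)) (cong (λ q → ℚz i + q) (ℚz-homo‿- j))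

ℚz-injective : ∀ {i j} → ℚz i ≡ ℚz j → i ≡ j
ℚz-injective {i} {j} eq with ℚᵘP.≃-trans (ℚᵘP.≃-sym (toℚᵘ-ℚz i)) (ℚᵘP.≃-trans (ℚP.toℚᵘ-cong eq) (toℚᵘ-ℚz j))
... | *≡* i*1≡j*1 = trans (sym (ℤP.*-identityʳ i)) (trans i*1≡j*1 (ℤP.*-identityʳ j))

ℚz-mono-≤ : ∀ {i j} → i ℤ.≤ j → ℚz i ≤ ℚz j
ℚz-mono-≤ {i} {j} i≤j = ℚP.toℚᵘ-cancel-≤ (begin
  toℚᵘ (ℚz i)  ≃⟨ toℚᵘ-ℚz i ⟩
  ι i          ≤⟨ *≤* (subst₂ ℤ._≤_ (sym (ℤP.*-identityʳ i)) (sym (ℤP.*-identityʳ j)) i≤j) ⟩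
  ι j          ≃⟨ toℚᵘ-ℚz j ⟨
  toℚᵘ (ℚz j)  ∎)
  where open ℚᵘP.≤-Reasoning

ℚz-cancel-< : ∀ {i j} → ℚz i < ℚz j → i ℤ.< j
ℚz-cancel-< {i} {j} lt with ℚᵘP.<-respˡ-≃ (toℚᵘ-ℚz i) (ℚᵘP.<-respʳ-≃ (toℚᵘ-ℚz j) (ℚP.toℚᵘ-mono-< lt))
... | *<* i*1<j*1 = subst₂ ℤ._<_ (ℤP.*-identityʳ i) (ℤP.*-identityʳ j) i*1<j*1

i/n*n≡i : ∀ i n .{{_ : NonZero n}} → (i / n) * ℚn n ≡ ℚz i
i/n*n≡i i n@(suc k) = ℚP.toℚᵘ-injective (begin
  toℚᵘ ((i / n) * ℚn n)          ≈⟨ ℚP.toℚᵘ-homo-* (i / n) (ℚn n) ⟩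
  toℚᵘ (i / n) ℚᵘ.* toℚᵘ (ℚn n)  ≈⟨ ℚᵘP.*-cong (ℚP.toℚᵘ-fromℚᵘ (mkℚᵘ i k)) (toℚᵘ-ℚz (+ n)) ⟩
  mkℚᵘ i k ℚᵘ.* ι (+ n)          ≈⟨ *≡* (trans (ℤP.*-identityʳ (i ℤ.* + n))
                                                (cong (λ m → i ℤ.* + m) (sym (ℕP.*-identityʳ n)))) ⟩
  ι i                            ≈⟨ toℚᵘ-ℚz i ⟨
  toℚᵘ (ℚz i)                    ∎)
  where open ℚᵘP.≃-Reasoning

ℚn-homo-* : ∀ m n → ℚn (m ℕ.* n) ≡ ℚn m * ℚn n
ℚn-homo-* m n = trans (cong ℚz (ℤP.pos-* m n)) (ℚz-homo-* (+ m) (+ n))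

ℚn-mono-≤ : ∀ {m n} → m ℕ.≤ n → ℚn m ≤ ℚn n
ℚn-mono-≤ = ℚz-mono-≤ ∘ ℤ.+≤+

ℚn-pos : ∀ n .{{_ : NonZero n}} → 0ℚ < ℚn n
ℚn-pos n = ℚP.positive⁻¹ (ℚn n) {{ℚP.normalize-pos n 1}}

Integral : ℚ → Set
Integral q = ∃[ i ] q ≡ ℚz i

integral-ℚn : ∀ n → Integral (ℚn n)
integral-ℚn n = + n , refl

integral-+ : ∀ {p q} → Integral p → Integral q → Integral (p + q)
integral-+ (i , refl) (j , refl) = i ℤ.+ j , sym (ℚz-homo-+ i j)

integral-* : ∀ {p q} → Integral p → Integral q → Integral (p * q)
integral-* (i , refl) (j , refl) = i ℤ.* j , sym (ℚz-homo-* i j)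

integral-- : ∀ {p q} → Integral p → Integral q → Integral (p - q)
integral-- (i , refl) (j , refl) = i ℤ.- j , sym (ℚz-homo-- i j)

integral-±1 : ∀ {n} → n ≡ 1ℚ ⊎ n ≡ - 1ℚ → Integral n
integral-±1 (inj₁ n≡1)  = 1ℤ , n≡1
integral-±1 (inj₂ n≡-1) = -[1+ 0 ] , n≡-1

integral-pos⇒ℚn : ∀ {q} → Integral q → 0ℚ < q → ∃[ n ] (0 ℕ.< n × q ≡ ℚn n)
integral-pos⇒ℚn (+ n , refl) 0<q = n , ℤP.drop‿+<+ (ℚz-cancel-< 0<q) , refl
integral-pos⇒ℚn (-[1+ n ] , refl) 0<q with ℚz-cancel-< {0ℤ} { -[1+ n ]} 0<q
... | ()

p≤p+q : ∀ p {q} → 0ℚ ≤ q → p ≤ p + q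
p≤p+q p 0≤q = subst (_≤ p + _) (ℚP.+-identityʳ p) (ℚP.+-monoʳ-≤ p 0≤q)

p<p+q : ∀ p {q} → 0ℚ < q → p < p + q
p<p+q p 0<q = subst (_< p + _) (ℚP.+-identityʳ p) (ℚP.+-monoʳ-< p 0<q)

p≤q⇒0≤q-p : ∀ {p q} → p ≤ q → 0ℚ ≤ q - p
p≤q⇒0≤q-p {p} {q} p≤q = subst (_≤ q - p) (ℚP.+-inverseʳ p) (ℚP.+-monoˡ-≤ (- p) p≤q)

p<q⇒0<q-p : ∀ {p q} → p < q → 0ℚ < q - p
p<q⇒0<q-p {p} {q} p<q = subst (_< q - p) (ℚP.+-inverseʳ p) (ℚP.+-monoˡ-< (- p) p<q)

0≤p*q : ∀ {p q} → 0ℚ ≤ p → 0ℚ ≤ q → 0ℚ ≤ p * q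
0≤p*q {p} {q} 0≤p 0≤q =
  ℚP.nonNegative⁻¹ _ {{ℚP.nonNeg*nonNeg⇒nonNeg p {{ℚ.nonNegative 0≤p}} q {{ℚ.nonNegative 0≤q}}}}

0<p*q : ∀ {p q} → 0ℚ < p → 0ℚ < q → 0ℚ < p * q
0<p*q {p} {q} 0<p 0<q = ℚP.positive⁻¹ _ {{ℚP.pos*pos⇒pos p {{ℚ.positive 0<p}} q {{ℚ.positive 0<q}}}}

0≤p*p : ∀ p → 0ℚ ≤ p * p
0≤p*p p with ℚP.≤-total 0ℚ p
... | inj₁ 0≤p = 0≤p*q 0≤p 0≤p
... | inj₂ p≤0 = ℚP.nonNegative⁻¹ _ {{ℚP.nonPos*nonPos⇒nonPos p {{ℚ.nonPositive p≤0}} p {{ℚ.nonPositive p≤0}}}}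

*-mono-≤-nonNeg : ∀ {p q r s} → 0ℚ ≤ p → 0ℚ ≤ r → p ≤ q → r ≤ s → p * r ≤ q * s
*-mono-≤-nonNeg {p} {q} {r} {s} 0≤p 0≤r p≤q r≤s = begin
  p * r  ≤⟨ ℚP.*-monoʳ-≤-nonNeg r {{ℚ.nonNegative 0≤r}} p≤q ⟩
  q * r  ≤⟨ ℚP.*-monoˡ-≤-nonNeg q {{ℚ.nonNegative (ℚP.≤-trans 0≤p p≤q)}} r≤s ⟩
  q * s  ∎
  where open ℚP.≤-Reasoning

*-cancelʳ-≡-pos : ∀ {p q} r .{{_ : ℚ.Positive r}} → p * r ≡ q * r → p ≡ q
*-cancelʳ-≡-pos r eq =
  ℚP.≤-antisym (ℚP.*-cancelʳ-≤-pos r (ℚP.≤-reflexive eq)) (ℚP.*-cancelʳ-≤-pos r (ℚP.≤-reflexive (sym eq)))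

x+y≡z⇒x≡z-y : ∀ {x y z} → x + y ≡ z → x ≡ z - y
x+y≡z⇒x≡z-y {x} {y} refl = solve (x ∷ y ∷ []) ℚ-ring

±1*±1≡1 : ∀ {n} → n ≡ 1ℚ ⊎ n ≡ - 1ℚ → n * n ≡ 1ℚ
±1*±1≡1 (inj₁ refl) = refl
±1*±1≡1 (inj₂ refl) = refl

c*W≤W-[1-c]*W₀ : ∀ c {W₀ W} → 0ℚ ≤ 1ℚ - c → W₀ ≤ W → c * W ≤ W - (1ℚ - c) * W₀
c*W≤W-[1-c]*W₀ c {W₀} {W} 0≤1-c W₀≤W = begin
  c * W                        ≤⟨ p≤p+q (c * W) (0≤p*q 0≤1-c (p≤q⇒0≤q-p W₀≤W)) ⟩
  c * W + (1ℚ - c) * (W - W₀)  ≡⟨ solve (c ∷ W₀ ∷ W ∷ []) ℚ-ring ⟩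
  W - (1ℚ - c) * W₀            ∎
  where open ℚP.≤-Reasoning

n+[1+m]≡n+m+1 : ∀ n m → n ℤ.+ + suc m ≡ n ℤ.+ + m ℤ.+ 1ℤ
n+[1+m]≡n+m+1 n m = identity n (+ m)
  where identity : ∀ n j → n ℤ.+ (1ℤ ℤ.+ j) ≡ n ℤ.+ j ℤ.+ 1ℤ
        identity = ℤ-Solver.solve-∀

n-[1+m]≡n-m-1 : ∀ n m → n ℤ.- + suc m ≡ n ℤ.- + m ℤ.- 1ℤ
n-[1+m]≡n-m-1 n m = identity n (+ m)
  where identity : ∀ n j → n ℤ.- (1ℤ ℤ.+ j) ≡ n ℤ.- j ℤ.- 1ℤ
        identity = ℤ-Solver.solve-∀

n+m≡n+[1+m]-1 : ∀ n m → n ℤ.+ + m ≡ n ℤ.+ + suc m ℤ.- 1ℤ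
n+m≡n+[1+m]-1 n m = identity n (+ m)
  where identity : ∀ n j → n ℤ.+ j ≡ n ℤ.+ (1ℤ ℤ.+ j) ℤ.- 1ℤ
        identity = ℤ-Solver.solve-∀

n-m≡n-[1+m]+1 : ∀ n m → n ℤ.- + m ≡ n ℤ.- + suc m ℤ.+ 1ℤ
n-m≡n-[1+m]+1 n m = identity n (+ m)
  where identity : ∀ n j → n ℤ.- j ≡ n ℤ.- (1ℤ ℤ.+ j) ℤ.+ 1ℤ
        identity = ℤ-Solver.solve-∀

i-1+1≡i : ∀ i → i ℤ.- 1ℤ ℤ.+ 1ℤ ≡ i
i-1+1≡i = ℤ-Solver.solve-∀

i+1-1≡i : ∀ i → i ℤ.+ 1ℤ ℤ.- 1ℤ ≡ i
i+1-1≡i = ℤ-Solver.solve-∀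

k≤n⇒k≡n-∣n-k∣ : ∀ {k n} → k ℤ.≤ n → k ≡ n ℤ.- + ℤ.∣ n ℤ.- k ∣
k≤n⇒k≡n-∣n-k∣ {k} {n} k≤n = begin
  k                      ≡⟨ identity k n ⟩
  n ℤ.- (n ℤ.- k)        ≡⟨ cong (λ j → n ℤ.- j) (ℤP.0≤i⇒+∣i∣≡i (ℤP.i≤j⇒0≤j-i k≤n)) ⟨
  n ℤ.- + ℤ.∣ n ℤ.- k ∣  ∎
  where
  open ≡-Reasoning
  identity : ∀ k n → k ≡ n ℤ.- (n ℤ.- k)
  identity = ℤ-Solver.solve-∀

i<0⇒+∣i∣≡-i : ∀ {i} → i ℤ.< 0ℤ → + ℤ.∣ i ∣ ≡ ℤ.- i
i<0⇒+∣i∣≡-i { -[1+ n ]} _          = refl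
i<0⇒+∣i∣≡-i { + n}      (ℤ.+<+ ())

i<0⇒0<∣i∣ : ∀ {i} → i ℤ.< 0ℤ → 0 ℕ.< ℤ.∣ i ∣
i<0⇒0<∣i∣ { -[1+ n ]} _          = s≤s z≤n
i<0⇒0<∣i∣ { + n}      (ℤ.+<+ ())

t²-w≡±4⇒5≤w : ∀ t w → 1 ℕ.≤ t → 1 ℕ.≤ w → t ℕ.* t ≡ 4 ℕ.+ w ⊎ w ≡ 4 ℕ.+ t ℕ.* t → 5 ℕ.≤ w
t²-w≡±4⇒5≤w t w 1≤t _ (inj₂ refl)                       = ℕP.+-monoʳ-≤ 4 (ℕP.*-mono-≤ 1≤t 1≤t)
t²-w≡±4⇒5≤w (suc zero) w _ _ (inj₁ ())
t²-w≡±4⇒5≤w (suc (suc zero)) (suc w) _ _ (inj₁ ())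
t²-w≡±4⇒5≤w t@(suc (suc (suc _))) w _ _ (inj₁ t²≡4+w) =
  ℕP.+-cancelˡ-≤ 4 5 w (subst (9 ℕ.≤_) t²≡4+w (ℕP.*-mono-≤ 3≤t 3≤t))
  where 3≤t : 3 ℕ.≤ t
        3≤t = s≤s (s≤s (s≤s z≤n))

conjD : QD → QD
conjD (p , q) = (p , - q)

sqD : ℕ → QD → QD
sqD d v = mulD d v v

powD : ℕ → QD → ℕ → QD
powD d v zero    = (1ℚ , 0ℚ)
powD d v (suc m) = mulD d v (powD d v m)

normD : ℕ → QD → ℚ
normD d (p , q) = p * p - ℚn d * q * q

-- Copies of mulD, sqD and conjD on solver polynomials: an identity in ℚ(√d) is checked by
-- solving its two coordinates separately.
private
  open +-*-Solver using (Polynomial; _:+_; _:*_; _:-_; :-_; con; _:=_)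
    renaming (solve to solve-poly)

  PolyD : ℕ → Set
  PolyD n = Polynomial n × Polynomial n

  mulP : ∀ {n} → Polynomial n → PolyD n → PolyD n → PolyD n
  mulP D (x , y) (p , q) = (x :* p :+ D :* y :* q , x :* q :+ y :* p)

  sqP : ∀ {n} → Polynomial n → PolyD n → PolyD n
  sqP D v = mulP D v v

  conjP : ∀ {n} → PolyD n → PolyD n
  conjP (p , q) = (p , :- q)

  infix 4 _:=₁_ _:=₂_
  _:=₁_ _:=₂_ : ∀ {n} → PolyD n → PolyD n → Polynomial n × Polynomial n
  (l , _) :=₁ (r , _) = l := r
  (_ , l) :=₂ (_ , r) = l := r

mulD-identityʳ : ∀ d v → mulD d v (1ℚ , 0ℚ) ≡ v
mulD-identityʳ d (x , y) = cong₂ _,_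
  (solve-poly 3 (λ x y D → mulP D (x , y) (con 1ℚ , con 0ℚ) :=₁ (x , y)) refl x y (ℚn d))
  (solve-poly 3 (λ x y D → mulP D (x , y) (con 1ℚ , con 0ℚ) :=₂ (x , y)) refl x y (ℚn d))

mulD-conj : ∀ d v w → conjD (mulD d v w) ≡ mulD d (conjD v) (conjD w)
mulD-conj d (x , y) (p , q) = cong₂ _,_
  (solve-poly 5 (λ x y p q D → conjP (mulP D (x , y) (p , q)) :=₁ mulP D (conjP (x , y)) (conjP (p , q)))
    refl x y p q (ℚn d))
  (solve-poly 5 (λ x y p q D → conjP (mulP D (x , y) (p , q)) :=₂ mulP D (conjP (x , y)) (conjP (p , q)))
    refl x y p q (ℚn d))

mulD-sq-mulD-sq : ∀ d v z η → mulD d (mulD d v (sqD d z)) (sqD d η) ≡ mulD d v (sqD d (mulD d η z))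
mulD-sq-mulD-sq d (x , y) (p , q) (r , s) = cong₂ _,_
  (solve-poly 7 (λ x y p q r s D → mulP D (mulP D (x , y) (sqP D (p , q))) (sqP D (r , s))
                                    :=₁ mulP D (x , y) (sqP D (mulP D (r , s) (p , q))))
    refl x y p q r s (ℚn d))
  (solve-poly 7 (λ x y p q r s D → mulP D (mulP D (x , y) (sqP D (p , q))) (sqP D (r , s))
                                    :=₂ mulP D (x , y) (sqP D (mulP D (r , s) (p , q))))
    refl x y p q r s (ℚn d))

mulD-sq-sq-conj : ∀ d v e → mulD d (mulD d v (sqD d e)) (sqD d (conjD e))
                            ≡ mulD d v (normD d e * normD d e , 0ℚ)
mulD-sq-sq-conj d (x , y) (p , q) = cong₂ _,_
  (solve-poly 5 (λ x y p q D → mulP D (mulP D (x , y) (sqP D (p , q))) (sqP D (conjP (p , q)))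
                                :=₁ mulP D (x , y) (norm D p q :* norm D p q , con 0ℚ))
    refl x y p q (ℚn d))
  (solve-poly 5 (λ x y p q D → mulP D (mulP D (x , y) (sqP D (p , q))) (sqP D (conjP (p , q)))
                                :=₂ mulP D (x , y) (norm D p q :* norm D p q , con 0ℚ))
    refl x y p q (ℚn d))
  where norm : ∀ {n} → Polynomial n → Polynomial n → Polynomial n → Polynomial n
        norm D p q = p :* p :- D :* q :* q

mulD-trace : ∀ d v w → proj₂ (mulD d v w) + proj₂ (mulD d v (conjD w)) ≡ (proj₁ w + proj₁ w) * proj₂ v
mulD-trace d (x , y) (p , q) =
  solve-poly 5 (λ x y p q D → proj₂ (mulP D (x , y) (p , q)) :+ proj₂ (mulP D (x , y) (conjP (p , q)))
                               := (p :+ p) :* y)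
    refl x y p q (ℚn d)

proj₂-mulD-sq : ∀ d A B p r → B * proj₂ (mulD d (A , B) (sqD d (p , r)))
                               ≡ (ℚn d * B * B - A * A) * (r * r) + (B * p + A * r) * (B * p + A * r)
proj₂-mulD-sq d A B p r =
  solve-poly 5 (λ A B p r D → B :* proj₂ (mulP D (A , B) (sqP D (p , r)))
                               := (D :* B :* B :- A :* A) :* (r :* r) :+ (B :* p :+ A :* r) :* (B :* p :+ A :* r))
    refl A B p r (ℚn d)

powD-conj : ∀ d v m → powD d (conjD v) m ≡ conjD (powD d v m)
powD-conj d v zero    = refl
powD-conj d v (suc m) = trans (cong (mulD d (conjD v)) (powD-conj d v m)) (sym (mulD-conj d v (powD d v m)))

orbit-closed-form : ∀ d η (v : ℕ → QD) → (∀ m → v (suc m) ≡ mulD d (v m) (sqD d η)) →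
                    ∀ m → v m ≡ mulD d (v 0) (sqD d (powD d η m))
orbit-closed-form d η v step zero =
  sym (trans (cong (mulD d (v 0)) (mulD-identityʳ d (1ℚ , 0ℚ))) (mulD-identityʳ d (v 0)))
orbit-closed-form d η v step (suc m) = begin
  v (suc m)
    ≡⟨ step m ⟩
  mulD d (v m) (sqD d η)
    ≡⟨ cong (λ w → mulD d w (sqD d η)) (orbit-closed-form d η v step m) ⟩
  mulD d (mulD d (v 0) (sqD d (powD d η m))) (sqD d η)
    ≡⟨ mulD-sq-mulD-sq d (v 0) (powD d η m) η ⟩
  mulD d (v 0) (sqD d (powD d η (suc m)))
    ∎
  where open ≡-Reasoning

½ : ℚ
½ = + 1 / 2

mulD-bounds : ∀ d {τ υ p q} → 1ℚ ≤ ℚn d → ½ ≤ τ → ½ ≤ υ → ½ ≤ p → υ ≤ q →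
              ½ ≤ proj₁ (mulD d (τ , υ) (p , q)) × υ ≤ proj₂ (mulD d (τ , υ) (p , q))
mulD-bounds d {τ} {υ} {p} {q} 1≤D ½≤τ ½≤υ ½≤p υ≤q = ½≤τp+Dυq , υ≤τq+υp
  where
  open ℚP.≤-Reasoning
  0≤½ : 0ℚ ≤ ½
  0≤½ = ℚP.nonNegative⁻¹ ½
  0≤υ : 0ℚ ≤ υ
  0≤υ = ℚP.≤-trans 0≤½ ½≤υ
  ½≤τp+Dυq : ½ ≤ τ * p + ℚn d * υ * q
  ½≤τp+Dυq = begin
    ½                     ≡⟨⟩
    ½ * ½ + 1ℚ * ½ * ½    ≤⟨ ℚP.+-mono-≤ (*-mono-≤-nonNeg 0≤½ 0≤½ ½≤τ ½≤p)
                                (*-mono-≤-nonNeg 0≤½ 0≤½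
                                  (*-mono-≤-nonNeg (ℚP.nonNegative⁻¹ 1ℚ) 0≤½ 1≤D ½≤υ) (ℚP.≤-trans ½≤υ υ≤q)) ⟩
    τ * p + ℚn d * υ * q  ∎
  υ≤τq+υp : υ ≤ τ * q + υ * p
  υ≤τq+υp = begin
    υ                     ≡⟨ solve (υ ∷ []) ℚ-ring ⟩
    ½ * υ + υ * ½         ≤⟨ ℚP.+-mono-≤ (*-mono-≤-nonNeg 0≤½ 0≤υ ½≤τ υ≤q)
                                (ℚP.*-monoˡ-≤-nonNeg υ {{ℚ.nonNegative 0≤υ}} ½≤p) ⟩
    τ * q + υ * p         ∎

powD-bounds : ∀ d {τ υ} → 1ℚ ≤ ℚn d → ½ ≤ τ → ½ ≤ υ →
              ∀ m → ½ ≤ proj₁ (powD d (τ , υ) (suc m)) × υ ≤ proj₂ (powD d (τ , υ) (suc m))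
powD-bounds d {τ} {υ} 1≤D ½≤τ ½≤υ zero =
  subst (λ w → ½ ≤ proj₁ w × υ ≤ proj₂ w) (sym (mulD-identityʳ d (τ , υ))) (½≤τ , ℚP.≤-refl)
powD-bounds d 1≤D ½≤τ ½≤υ (suc m) =
  let ½≤p , υ≤q = powD-bounds d 1≤D ½≤τ ½≤υ m in mulD-bounds d 1≤D ½≤τ ½≤υ ½≤p υ≤q

Recurrent : ℚ → (ℕ → ℚ) → Set
Recurrent T s = ∀ m → s (suc (suc m)) + s m ≡ T * s (suc m)

Recurrentℤ : ℚ → (ℤ → ℚ) → Set
Recurrentℤ T y = ∀ k → y (k ℤ.+ 1ℤ) + y (k ℤ.- 1ℤ) ≡ T * y k

module _ {T : ℚ} {s : ℕ → ℚ} (rec : Recurrent T s) (m : ℕ) where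

  private
    x y : ℚ
    x = s m
    y = s (suc m)

  recurrent-step-< : ℚn 2 ≤ T → 0ℚ ≤ y → x < y → y < s (suc (suc m))
  recurrent-step-< 2≤T 0≤y x<y = begin-strict
    y                               <⟨ p<p+q y (ℚP.+-mono-<-≤ (p<q⇒0<q-p x<y) (0≤p*q (p≤q⇒0≤q-p 2≤T) 0≤y)) ⟩
    y + ((y - x) + (T - ℚn 2) * y)  ≡⟨ rearrange T x y ⟩
    T * y - x                       ≡⟨ x+y≡z⇒x≡z-y (rec m) ⟨
    s (suc (suc m))                 ∎
    where
    open ℚP.≤-Reasoning
    rearrange : ∀ T x y → y + ((y - x) + (T - ℚn 2) * y) ≡ T * y - x
    rearrange = solve-∀ ℚ-ring

  recurrent-step-growth : x ≤ y → (T - 1ℚ) * y ≤ s (suc (suc m))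
  recurrent-step-growth x≤y = begin
    (T - 1ℚ) * y            ≤⟨ p≤p+q ((T - 1ℚ) * y) (p≤q⇒0≤q-p x≤y) ⟩
    (T - 1ℚ) * y + (y - x)  ≡⟨ rearrange T x y ⟩
    T * y - x               ≡⟨ x+y≡z⇒x≡z-y (rec m) ⟨
    s (suc (suc m))         ∎
    where
    open ℚP.≤-Reasoning
    rearrange : ∀ T x y → (T - 1ℚ) * y + (y - x) ≡ T * y - x
    rearrange = solve-∀ ℚ-ring

integral-recurrent : ∀ {T s} → Recurrent T s → Integral T → Integral (s 0) → Integral (s 1) →
                     ∀ m → Integral (s m)
integral-recurrent {T} {s} rec ∫T ∫s₀ ∫s₁ = proj₁ ∘ consecutive
  where
  consecutive : ∀ m → Integral (s m) × Integral (s (suc m))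
  consecutive zero    = ∫s₀ , ∫s₁
  consecutive (suc m) =
    let ∫sₘ , ∫sₘ₊₁ = consecutive m
    in ∫sₘ₊₁ , subst Integral (sym (x+y≡z⇒x≡z-y (rec m))) (integral-- (integral-* ∫T ∫sₘ₊₁) ∫sₘ)

module IncreasingRecurrence {T : ℚ} {s : ℕ → ℚ} (2≤T : ℚn 2 ≤ T) (rec : Recurrent T s)
                            (0≤s₀ : 0ℚ ≤ s 0) (s₀<s₁ : s 0 < s 1) where

  private
    nonNegative-increasing : ∀ m → 0ℚ ≤ s m × s m < s (suc m)
    nonNegative-increasing zero    = 0≤s₀ , s₀<s₁
    nonNegative-increasing (suc m) =
      let 0≤sₘ , sₘ<sₘ₊₁ = nonNegative-increasing m
          0≤sₘ₊₁ : 0ℚ ≤ s (suc m)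
          0≤sₘ₊₁ = ℚP.≤-trans 0≤sₘ (ℚP.<⇒≤ sₘ<sₘ₊₁)
      in 0≤sₘ₊₁ , recurrent-step-< {T} {s} rec m 2≤T 0≤sₘ₊₁ sₘ<sₘ₊₁

  increasing : ∀ m → s m < s (suc m)
  increasing = proj₂ ∘ nonNegative-increasing

  geometric-lower-bound : ∀ {C r} → 0ℚ ≤ r → r ≤ T - 1ℚ → C ≤ s 1 → ∀ m → C * (r ^ℚ m) ≤ s (suc m)
  geometric-lower-bound {C} {r} 0≤r r≤T-1 C≤s₁ = bound
    where
    open ℚP.≤-Reasoning
    bound : ∀ m → C * (r ^ℚ m) ≤ s (suc m)
    bound zero    = subst (_≤ s 1) (sym (ℚP.*-identityʳ C)) C≤s₁
    bound (suc m) = begin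
      C * (r * r ^ℚ m)      ≡⟨ x∙yz≈y∙xz C r (r ^ℚ m) ⟩
      r * (C * r ^ℚ m)      ≤⟨ ℚP.*-monoˡ-≤-nonNeg r {{ℚ.nonNegative 0≤r}} (bound m) ⟩
      r * s (suc m)         ≤⟨ ℚP.*-monoʳ-≤-nonNeg (s (suc m)) {{ℚ.nonNegative 0≤sₘ₊₁}} r≤T-1 ⟩
      (T - 1ℚ) * s (suc m)  ≤⟨ recurrent-step-growth {T} {s} rec m (ℚP.<⇒≤ (increasing m)) ⟩
      s (suc (suc m))       ∎
      where 0≤sₘ₊₁ : 0ℚ ≤ s (suc m)
            0≤sₘ₊₁ = proj₁ (nonNegative-increasing (suc m))

module _ {T : ℚ} {y : ℤ → ℚ} (rec : Recurrentℤ T y) where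

  recurrent-forward : ∀ n → Recurrent T (λ m → y (n ℤ.+ + m))
  recurrent-forward n m =
    subst₂ (λ i j → y i + y j ≡ T * y (n ℤ.+ + suc m))
      (sym (n+[1+m]≡n+m+1 n (suc m))) (sym (n+m≡n+[1+m]-1 n m))
      (rec (n ℤ.+ + suc m))

  recurrent-backward : ∀ n → Recurrent T (λ m → y (n ℤ.- + m))
  recurrent-backward n m =
    subst₂ (λ i j → y i + y j ≡ T * y (n ℤ.- + suc m))
      (sym (n-[1+m]≡n-m-1 n (suc m))) (sym (n-m≡n-[1+m]+1 n m))
      (trans (ℚP.+-comm (y (n ℤ.- + suc m ℤ.- 1ℤ)) (y (n ℤ.- + suc m ℤ.+ 1ℤ))) (rec (n ℤ.- + suc m)))

  recurrentℤ-scale : ∀ c → Recurrentℤ T (λ k → c * y k)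
  recurrentℤ-scale c k = begin
    c * y (k ℤ.+ 1ℤ) + c * y (k ℤ.- 1ℤ)  ≡⟨ ℚP.*-distribˡ-+ c (y (k ℤ.+ 1ℤ)) (y (k ℤ.- 1ℤ)) ⟨
    c * (y (k ℤ.+ 1ℤ) + y (k ℤ.- 1ℤ))    ≡⟨ cong (c *_) (rec k) ⟩
    c * (T * y k)                        ≡⟨ x∙yz≈y∙xz c T (y k) ⟩
    T * (c * y k)                        ∎
    where open ≡-Reasoning

  integral-recurrentℤ : Integral T → Integral (y 0ℤ) → Integral (y 1ℤ) → ∀ k → Integral (y k)
  integral-recurrentℤ ∫T ∫y₀ ∫y₁ (+ m)     =
    integral-recurrent {s = λ m → y (+ m)} (recurrent-forward 0ℤ) ∫T ∫y₀ ∫y₁ m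
  integral-recurrentℤ ∫T ∫y₀ ∫y₁ -[1+ m ] =
    integral-recurrent {s = λ m → y (1ℤ ℤ.- + m)} (recurrent-backward 1ℤ) ∫T ∫y₁ ∫y₀ (suc (suc m))

module _ {W : ℚ} (5≤W : ℚn 5 ≤ W) where

  2≤W+2N : ∀ {N} → N ≡ 1ℚ ⊎ N ≡ - 1ℚ → ℚn 2 ≤ W + (N + N)
  2≤W+2N (inj₁ refl) = begin
    ℚn 2               ≤⟨ p≤p+q (ℚn 2) (ℚP.≤-trans (ℚP.nonNegative⁻¹ (ℚn 5)) 5≤W) ⟩
    ℚn 2 + W           ≡⟨ solve (W ∷ []) ℚ-ring ⟩
    W + (1ℚ + 1ℚ)      ∎
    where open ℚP.≤-Reasoning
  2≤W+2N (inj₂ refl) = begin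
    ℚn 2               ≤⟨ p≤p+q (ℚn 2) (p≤q⇒0≤q-p (ℚP.≤-trans (ℚP.≤ᵇ⇒≤ {ℚn 4} {ℚn 5} _) 5≤W)) ⟩
    ℚn 2 + (W - ℚn 4)  ≡⟨ solve (W ∷ []) ℚ-ring ⟩
    W + (- 1ℚ + - 1ℚ)  ∎
    where open ℚP.≤-Reasoning

  W-3≤W+2N-1 : ∀ {N} → N ≡ 1ℚ ⊎ N ≡ - 1ℚ → W - ℚn 3 ≤ W + (N + N) - 1ℚ
  W-3≤W+2N-1 (inj₁ refl) = begin
    W - ℚn 3            ≤⟨ p≤p+q (W - ℚn 3) (ℚP.nonNegative⁻¹ (ℚn 4)) ⟩
    W - ℚn 3 + ℚn 4     ≡⟨ solve (W ∷ []) ℚ-ring ⟩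
    W + (1ℚ + 1ℚ) - 1ℚ  ∎
    where open ℚP.≤-Reasoning
  W-3≤W+2N-1 (inj₂ refl) = ℚP.≤-reflexive (solve (W ∷ []) ℚ-ring)

W≤W+2-1 : ∀ W → W ≤ W + (1ℚ + 1ℚ) - 1ℚ
W≤W+2-1 W = begin
  W                   ≤⟨ p≤p+q W (ℚP.nonNegative⁻¹ 1ℚ) ⟩
  W + 1ℚ              ≡⟨ solve (W ∷ []) ℚ-ring ⟩
  W + (1ℚ + 1ℚ) - 1ℚ  ∎
  where open ℚP.≤-Reasoning

module Unit (d t u : ℕ) .{{_ : NonZero d}} .{{_ : NonZero t}} .{{_ : NonZero u}}
            (norm±1 : normEps d t u ≡ 1ℚ ⊎ normEps d t u ≡ - 1ℚ) where

  ε : QD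
  ε = epsD t u

  τ υ D W N T : ℚ
  τ = proj₁ ε
  υ = proj₂ ε
  D = ℚn d
  W = ℚn (d ℕ.* u ℕ.* u)
  N = normEps d t u
  T = proj₁ (sqD d ε) + proj₁ (sqD d ε)

  ℚn-t≡τ*2 : ℚn t ≡ τ * ℚn 2
  ℚn-t≡τ*2 = sym (i/n*n≡i (+ t) 2)

  ℚn-u≡υ*2 : ℚn u ≡ υ * ℚn 2
  ℚn-u≡υ*2 = sym (i/n*n≡i (+ u) 2)

  W≡D*[υ*2]² : W ≡ D * (υ * ℚn 2) * (υ * ℚn 2)
  W≡D*[υ*2]² = begin
    ℚn (d ℕ.* u ℕ.* u)           ≡⟨ ℚn-homo-* (d ℕ.* u) u ⟩
    ℚn (d ℕ.* u) * ℚn u          ≡⟨ cong (_* ℚn u) (ℚn-homo-* d u) ⟩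
    D * ℚn u * ℚn u              ≡⟨ cong (λ v → D * v * v) ℚn-u≡υ*2 ⟩
    D * (υ * ℚn 2) * (υ * ℚn 2)  ∎
    where open ≡-Reasoning

  N≡normD : N ≡ normD d ε
  N≡normD = *-cancelʳ-≡-pos (ℚn 4) (begin
    N * ℚn 4                                             ≡⟨ i/n*n≡i (+ (t ℕ.* t) ℤ.- + (d ℕ.* u ℕ.* u)) 4 ⟩
    ℚz (+ (t ℕ.* t) ℤ.- + (d ℕ.* u ℕ.* u))               ≡⟨ ℚz-homo-- (+ (t ℕ.* t)) (+ (d ℕ.* u ℕ.* u)) ⟩
    ℚn (t ℕ.* t) - W                                     ≡⟨ cong (_- W) (ℚn-homo-* t t) ⟩
    ℚn t * ℚn t - W                                      ≡⟨ cong (λ v → v * v - W) ℚn-t≡τ*2 ⟩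
    τ * ℚn 2 * (τ * ℚn 2) - W                            ≡⟨ cong (λ w → τ * ℚn 2 * (τ * ℚn 2) - w) W≡D*[υ*2]² ⟩
    τ * ℚn 2 * (τ * ℚn 2) - D * (υ * ℚn 2) * (υ * ℚn 2)  ≡⟨ quadruple τ υ D ⟩
    normD d ε * ℚn 4                                     ∎)
    where
    open ≡-Reasoning
    quadruple : ∀ τ υ D → τ * ℚn 2 * (τ * ℚn 2) - D * (υ * ℚn 2) * (υ * ℚn 2) ≡ (τ * τ - D * υ * υ) * ℚn 4
    quadruple = solve-∀ ℚ-ring

  ε²-ε̄²-cancel : ∀ v → mulD d (mulD d v (sqD d ε)) (sqD d (conjD ε)) ≡ v
  ε²-ε̄²-cancel v = begin
    mulD d (mulD d v (sqD d ε)) (sqD d (conjD ε))  ≡⟨ mulD-sq-sq-conj d v ε ⟩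
    mulD d v (normD d ε * normD d ε , 0ℚ)          ≡⟨ cong (λ n → mulD d v (n * n , 0ℚ)) N≡normD ⟨
    mulD d v (N * N , 0ℚ)                          ≡⟨ cong (λ n → mulD d v (n , 0ℚ)) (±1*±1≡1 norm±1) ⟩
    mulD d v (1ℚ , 0ℚ)                             ≡⟨ mulD-identityʳ d v ⟩
    v                                              ∎
    where open ≡-Reasoning

  T≡W+2N : T ≡ W + (N + N)
  T≡W+2N = begin
    T                                                      ≡⟨ trace τ υ D ⟩
    D * (υ * ℚn 2) * (υ * ℚn 2) + (normD d ε + normD d ε)  ≡⟨ cong₂ (λ w n → w + (n + n)) W≡D*[υ*2]² N≡normD ⟨
    W + (N + N)                                            ∎
    where
    open ≡-Reasoning
    trace : ∀ τ υ D → (τ * τ + D * υ * υ) + (τ * τ + D * υ * υ)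
                      ≡ D * (υ * ℚn 2) * (υ * ℚn 2) + ((τ * τ - D * υ * υ) + (τ * τ - D * υ * υ))
    trace = solve-∀ ℚ-ring

  2*proj₂[ε²]≡t*u : ℚn 2 * proj₂ (sqD d ε) ≡ ℚn t * ℚn u
  2*proj₂[ε²]≡t*u = trans (double τ υ) (sym (cong₂ _*_ ℚn-t≡τ*2 ℚn-u≡υ*2))
    where double : ∀ τ υ → ℚn 2 * (τ * υ + υ * τ) ≡ τ * ℚn 2 * (υ * ℚn 2)
          double = solve-∀ ℚ-ring

  integral-T : Integral T
  integral-T = subst Integral (sym T≡W+2N)
                 (integral-+ (integral-ℚn (d ℕ.* u ℕ.* u)) (integral-+ (integral-±1 norm±1) (integral-±1 norm±1)))

  t²-du²≡4N : ∀ i → N ≡ ℚz i → + (t ℕ.* t) ℤ.- + (d ℕ.* u ℕ.* u) ≡ i ℤ.* + 4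
  t²-du²≡4N i N≡i = ℚz-injective (begin
    ℚz (+ (t ℕ.* t) ℤ.- + (d ℕ.* u ℕ.* u))  ≡⟨ i/n*n≡i (+ (t ℕ.* t) ℤ.- + (d ℕ.* u ℕ.* u)) 4 ⟨
    N * ℚn 4                                ≡⟨ cong (_* ℚn 4) N≡i ⟩
    ℚz i * ℚz (+ 4)                         ≡⟨ ℚz-homo-* i (+ 4) ⟨
    ℚz (i ℤ.* + 4)                          ∎)
    where open ≡-Reasoning

  t²≡4+du²⊎du²≡4+t² : t ℕ.* t ≡ 4 ℕ.+ d ℕ.* u ℕ.* u ⊎ d ℕ.* u ℕ.* u ≡ 4 ℕ.+ t ℕ.* t
  t²≡4+du²⊎du²≡4+t² = from-norm norm±1
    where
    open ≡-Reasoning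
    i≡[i-j]+j : ∀ i j → i ≡ i ℤ.- j ℤ.+ j
    i≡[i-j]+j = ℤ-Solver.solve-∀
    j≡-[i-j]+i : ∀ i j → j ≡ ℤ.- (i ℤ.- j) ℤ.+ i
    j≡-[i-j]+i = ℤ-Solver.solve-∀
    from-norm : N ≡ 1ℚ ⊎ N ≡ - 1ℚ → t ℕ.* t ≡ 4 ℕ.+ d ℕ.* u ℕ.* u ⊎ d ℕ.* u ℕ.* u ≡ 4 ℕ.+ t ℕ.* t
    from-norm (inj₁ N≡1) = inj₁ (ℤP.+-injective (begin
      + (t ℕ.* t)
        ≡⟨ i≡[i-j]+j (+ (t ℕ.* t)) (+ (d ℕ.* u ℕ.* u)) ⟩
      + (t ℕ.* t) ℤ.- + (d ℕ.* u ℕ.* u) ℤ.+ + (d ℕ.* u ℕ.* u)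
        ≡⟨ cong (ℤ._+ + (d ℕ.* u ℕ.* u)) (t²-du²≡4N 1ℤ N≡1) ⟩
      + 4 ℤ.+ + (d ℕ.* u ℕ.* u)
        ∎))
    from-norm (inj₂ N≡-1) = inj₂ (ℤP.+-injective (begin
      + (d ℕ.* u ℕ.* u)
        ≡⟨ j≡-[i-j]+i (+ (t ℕ.* t)) (+ (d ℕ.* u ℕ.* u)) ⟩
      ℤ.- (+ (t ℕ.* t) ℤ.- + (d ℕ.* u ℕ.* u)) ℤ.+ + (t ℕ.* t)
        ≡⟨ cong (λ k → ℤ.- k ℤ.+ + (t ℕ.* t)) (t²-du²≡4N -[1+ 0 ] N≡-1) ⟩
      + 4 ℤ.+ + (t ℕ.* t)
        ∎))

  5≤W : ℚn 5 ≤ W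
  5≤W = ℚn-mono-≤ (t²-w≡±4⇒5≤w t (d ℕ.* u ℕ.* u) (ℕ.>-nonZero⁻¹ t) 1≤du² t²≡4+du²⊎du²≡4+t²)
    where 1≤du² : 1 ℕ.≤ d ℕ.* u ℕ.* u
          1≤du² = ℕ.>-nonZero⁻¹ (d ℕ.* u ℕ.* u) {{ℕP.m*n≢0 (d ℕ.* u) u {{ℕP.m*n≢0 d u}}}}

  0≤W : 0ℚ ≤ W
  0≤W = ℚn-mono-≤ {0} {d ℕ.* u ℕ.* u} z≤n

  2≤T : ℚn 2 ≤ T
  2≤T = subst (ℚn 2 ≤_) (sym T≡W+2N) (2≤W+2N 5≤W norm±1)

  W-3≤T-1 : W - ℚn 3 ≤ T - 1ℚ
  W-3≤T-1 = subst (λ T → W - ℚn 3 ≤ T - 1ℚ) (sym T≡W+2N) (W-3≤W+2N-1 5≤W norm±1)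

  AdmissibleRatio : ℚ → Set
  AdmissibleRatio r = 0ℚ ≤ r × r ≤ T - 1ℚ

  admissible-du²-3 : AdmissibleRatio (W - ℚn 3)
  admissible-du²-3 = p≤q⇒0≤q-p (ℚP.≤-trans (ℚP.≤ᵇ⇒≤ {ℚn 3} {ℚn 5} _) 5≤W) , W-3≤T-1

  admissible-0·4du² : AdmissibleRatio ((+ 4 / 10) * W)
  admissible-0·4du² =
    0≤p*q (ℚP.nonNegative⁻¹ (+ 4 / 10)) 0≤W ,
    ℚP.≤-trans (c*W≤W-[1-c]*W₀ (+ 4 / 10) (ℚP.nonNegative⁻¹ (1ℚ - + 4 / 10)) 5≤W) W-3≤T-1

  admissible-0·99du² : N ≡ 1ℚ ⊎ 300 ℕ.≤ d ℕ.* u ℕ.* u → AdmissibleRatio ((+ 99 / 100) * W)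
  admissible-0·99du² h = 0≤p*q (ℚP.nonNegative⁻¹ (+ 99 / 100)) 0≤W , ≤T-1 h
    where
    ≤T-1 : N ≡ 1ℚ ⊎ 300 ℕ.≤ d ℕ.* u ℕ.* u → (+ 99 / 100) * W ≤ T - 1ℚ
    ≤T-1 (inj₁ N≡1) = begin
      (+ 99 / 100) * W    ≤⟨ ℚP.*-monoʳ-≤-nonNeg W {{ℚ.nonNegative 0≤W}} (ℚP.≤ᵇ⇒≤ {+ 99 / 100} {1ℚ} _) ⟩
      1ℚ * W              ≡⟨ ℚP.*-identityˡ W ⟩
      W                   ≤⟨ W≤W+2-1 W ⟩
      W + (1ℚ + 1ℚ) - 1ℚ  ≡⟨ cong (λ n → W + (n + n) - 1ℚ) N≡1 ⟨
      W + (N + N) - 1ℚ    ≡⟨ cong (_- 1ℚ) T≡W+2N ⟨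
      T - 1ℚ              ∎
      where open ℚP.≤-Reasoning
    ≤T-1 (inj₂ 300≤du²) =
      ℚP.≤-trans (c*W≤W-[1-c]*W₀ (+ 99 / 100) (ℚP.nonNegative⁻¹ (1ℚ - + 99 / 100)) (ℚn-mono-≤ 300≤du²)) W-3≤T-1

  ½≤τ : ½ ≤ τ
  ½≤τ = ℚP.*-cancelʳ-≤-pos (ℚn 2) (subst (1ℚ ≤_) ℚn-t≡τ*2 (ℚn-mono-≤ (ℕ.>-nonZero⁻¹ t)))

  ½≤υ : ½ ≤ υ
  ½≤υ = ℚP.*-cancelʳ-≤-pos (ℚn 2) (subst (1ℚ ≤_) ℚn-u≡υ*2 (ℚn-mono-≤ (ℕ.>-nonZero⁻¹ u)))

  0<υ : 0ℚ < υ
  0<υ = ℚP.<-≤-trans (ℚP.positive⁻¹ ½) ½≤υ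

  υ²≤proj₂[εᵐ⁺¹]² : ∀ m → υ * υ ≤ proj₂ (powD d ε (suc m)) * proj₂ (powD d ε (suc m))
  υ²≤proj₂[εᵐ⁺¹]² m = *-mono-≤-nonNeg 0≤υ 0≤υ υ≤q υ≤q
    where
    0≤υ : 0ℚ ≤ υ
    0≤υ = ℚP.<⇒≤ 0<υ
    υ≤q : υ ≤ proj₂ (powD d ε (suc m))
    υ≤q = proj₂ (powD-bounds d (ℚn-mono-≤ (ℕ.>-nonZero⁻¹ d)) ½≤τ ½≤υ m)

  υ²≤proj₂[ε̄ᵐ⁺¹]² : ∀ m → υ * υ ≤ proj₂ (powD d (conjD ε) (suc m)) * proj₂ (powD d (conjD ε) (suc m))
  υ²≤proj₂[ε̄ᵐ⁺¹]² m = subst (υ * υ ≤_) (sym (begin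
    proj₂ (powD d (conjD ε) (suc m)) * proj₂ (powD d (conjD ε) (suc m))
      ≡⟨ cong (λ w → proj₂ w * proj₂ w) (powD-conj d ε (suc m)) ⟩
    - q * - q
      ≡⟨ -p*-p≡p*p q ⟩
    q * q
      ∎)) (υ²≤proj₂[εᵐ⁺¹]² m)
    where
    open ≡-Reasoning
    q : ℚ
    q = proj₂ (powD d ε (suc m))
    -p*-p≡p*p : ∀ p → - p * - p ≡ p * p
    -p*-p≡p*p = solve-∀ ℚ-ring

module Orbit (a b d t u : ℕ) .{{_ : NonZero a}} .{{_ : NonZero b}} .{{_ : NonZero d}}
             .{{_ : NonZero t}} .{{_ : NonZero u}}
             (norm±1 : normEps d t u ≡ 1ℚ ⊎ normEps d t u ≡ - 1ℚ)
             (Nα<0 : Nalpha a b d ℤ.< 0ℤ)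
             (x y : ℤ → ℚ)
             (xy₀ : (x 0ℤ , y 0ℤ) ≡ (ℚn a , ℚn (b ℕ.* b)))
             (step : ∀ k → (x (k ℤ.+ 1ℤ) , y (k ℤ.+ 1ℤ)) ≡ mulD d (x k , y k) (sqD d (epsD t u)))
             where

  open Unit d t u norm±1 public

  A B M C : ℚ
  A = ℚn a
  B = ℚn (b ℕ.* b)
  M = ℚn ℤ.∣ Nalpha a b d ∣
  C = coef a b d u

  α : QD
  α = (A , B)

  xy : ℤ → QD
  xy k = (x k , y k)

  step-back : ∀ k → xy (k ℤ.- 1ℤ) ≡ mulD d (xy k) (sqD d (conjD ε))
  step-back k = begin
    xy (k ℤ.- 1ℤ)
      ≡⟨ ε²-ε̄²-cancel (xy (k ℤ.- 1ℤ)) ⟨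
    mulD d (mulD d (xy (k ℤ.- 1ℤ)) (sqD d ε)) (sqD d (conjD ε))
      ≡⟨ cong (λ v → mulD d v (sqD d (conjD ε))) (step (k ℤ.- 1ℤ)) ⟨
    mulD d (xy (k ℤ.- 1ℤ ℤ.+ 1ℤ)) (sqD d (conjD ε))
      ≡⟨ cong (λ j → mulD d (xy j) (sqD d (conjD ε))) (i-1+1≡i k) ⟩
    mulD d (xy k) (sqD d (conjD ε))
      ∎
    where open ≡-Reasoning

  y-recurrent : Recurrentℤ T y
  y-recurrent k = begin
    y (k ℤ.+ 1ℤ) + y (k ℤ.- 1ℤ)
      ≡⟨ cong₂ _+_ (cong proj₂ (step k)) (cong proj₂ (step-back k)) ⟩
    proj₂ (mulD d (xy k) (sqD d ε)) + proj₂ (mulD d (xy k) (sqD d (conjD ε)))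
      ≡⟨ cong (λ w → proj₂ (mulD d (xy k) (sqD d ε)) + proj₂ (mulD d (xy k) w)) (mulD-conj d ε ε) ⟨
    proj₂ (mulD d (xy k) (sqD d ε)) + proj₂ (mulD d (xy k) (conjD (sqD d ε)))
      ≡⟨ mulD-trace d (xy k) (sqD d ε) ⟩
    T * y k
      ∎
    where open ≡-Reasoning

  orbit-forward : ∀ m → xy (+ m) ≡ mulD d α (sqD d (powD d ε m))
  orbit-forward m = trans (orbit-closed-form d ε (λ m → xy (+ m)) forward m)
                          (cong (λ v → mulD d v (sqD d (powD d ε m))) xy₀)
    where forward : ∀ m → xy (+ suc m) ≡ mulD d (xy (+ m)) (sqD d ε)
          forward m = trans (cong xy (n+[1+m]≡n+m+1 0ℤ m)) (step (+ m))

  orbit-backward : ∀ m → xy (0ℤ ℤ.- + m) ≡ mulD d α (sqD d (powD d (conjD ε) m))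
  orbit-backward m = trans (orbit-closed-form d (conjD ε) (λ m → xy (0ℤ ℤ.- + m)) backward m)
                           (cong (λ v → mulD d v (sqD d (powD d (conjD ε) m))) xy₀)
    where backward : ∀ m → xy (0ℤ ℤ.- + suc m) ≡ mulD d (xy (0ℤ ℤ.- + m)) (sqD d (conjD ε))
          backward m = trans (cong xy (n-[1+m]≡n-m-1 0ℤ m)) (step-back (0ℤ ℤ.- + m))

  M≡D*B*B-A*A : M ≡ D * B * B - A * A
  M≡D*B*B-A*A = begin
    ℚn ℤ.∣ Nalpha a b d ∣         ≡⟨ cong ℚz (i<0⇒+∣i∣≡-i Nα<0) ⟩
    ℚz (ℤ.- Nalpha a b d)         ≡⟨ ℚz-homo‿- (Nalpha a b d) ⟩
    - ℚz (Nalpha a b d)           ≡⟨ cong -_ (ℚz-homo-- (+ (a ℕ.* a)) (+ b⁴d)) ⟩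
    - (ℚn (a ℕ.* a) - ℚn b⁴d)     ≡⟨ cong₂ (λ p q → - (p - q)) (ℚn-homo-* a a) b⁴d≡B*B*D ⟩
    - (A * A - B * B * D)         ≡⟨ rearrange A B D ⟩
    D * B * B - A * A             ∎
    where
    open ≡-Reasoning
    b⁴d : ℕ
    b⁴d = b ℕ.* b ℕ.* b ℕ.* b ℕ.* d
    b⁴d≡B*B*D : ℚn b⁴d ≡ B * B * D
    b⁴d≡B*B*D = begin
      ℚn (b ℕ.* b ℕ.* b ℕ.* b ℕ.* d)    ≡⟨ cong (λ n → ℚn (n ℕ.* d)) (ℕP.*-assoc (b ℕ.* b) b b) ⟩
      ℚn (b ℕ.* b ℕ.* (b ℕ.* b) ℕ.* d)  ≡⟨ ℚn-homo-* (b ℕ.* b ℕ.* (b ℕ.* b)) d ⟩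
      ℚn (b ℕ.* b ℕ.* (b ℕ.* b)) * D    ≡⟨ cong (_* D) (ℚn-homo-* (b ℕ.* b) (b ℕ.* b)) ⟩
      B * B * D                         ∎
    rearrange : ∀ A B D → - (A * A - B * B * D) ≡ D * B * B - A * A
    rearrange = solve-∀ ℚ-ring

  B*C≡M*υ² : B * C ≡ M * (υ * υ)
  B*C≡M*υ² = *-cancelʳ-≡-pos (ℚn 4) (begin
    B * C * ℚn 4                         ≡⟨ rearrange B C ⟩
    C * (ℚn 4 * B)                       ≡⟨ cong (C *_) 4b²≡4*B ⟨
    C * ℚn (4 ℕ.* b ℕ.* b)               ≡⟨ i/n*n≡i (+ (ℤ.∣ Nalpha a b d ∣ ℕ.* u ℕ.* u)) (4 ℕ.* b ℕ.* b)
                                              {{ℕP.m*n≢0 (4 ℕ.* b) b {{ℕP.m*n≢0 4 b}}}} ⟩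
    ℚn (ℤ.∣ Nalpha a b d ∣ ℕ.* u ℕ.* u)  ≡⟨ trans (ℚn-homo-* (ℤ.∣ Nalpha a b d ∣ ℕ.* u) u)
                                                  (cong (_* ℚn u) (ℚn-homo-* ℤ.∣ Nalpha a b d ∣ u)) ⟩
    M * ℚn u * ℚn u                      ≡⟨ cong (λ v → M * v * v) ℚn-u≡υ*2 ⟩
    M * (υ * ℚn 2) * (υ * ℚn 2)          ≡⟨ rearrange′ M υ ⟩
    M * (υ * υ) * ℚn 4                   ∎)
    where
    open ≡-Reasoning
    4b²≡4*B : ℚn (4 ℕ.* b ℕ.* b) ≡ ℚn 4 * B
    4b²≡4*B = trans (cong ℚn (ℕP.*-assoc 4 b b)) (ℚn-homo-* 4 (b ℕ.* b))
    rearrange : ∀ B C → B * C * ℚn 4 ≡ C * (ℚn 4 * B)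
    rearrange = solve-∀ ℚ-ring
    rearrange′ : ∀ M υ → M * (υ * ℚn 2) * (υ * ℚn 2) ≡ M * (υ * υ) * ℚn 4
    rearrange′ = solve-∀ ℚ-ring

  0<B : 0ℚ < B
  0<B = ℚn-pos (b ℕ.* b) {{ℕP.m*n≢0 b b}}

  0≤M : 0ℚ ≤ M
  0≤M = ℚn-mono-≤ {0} {ℤ.∣ Nalpha a b d ∣} z≤n

  0<C : 0ℚ < C
  0<C = ℚP.*-cancelˡ-<-nonNeg B {{ℚ.nonNegative (ℚP.<⇒≤ 0<B)}} (begin-strict
    B * 0ℚ       ≡⟨ ℚP.*-zeroʳ B ⟩
    0ℚ           <⟨ 0<p*q 0<M (0<p*q 0<υ 0<υ) ⟩
    M * (υ * υ)  ≡⟨ B*C≡M*υ² ⟨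
    B * C        ∎)
    where
    open ℚP.≤-Reasoning
    0<M : 0ℚ < M
    0<M = ℚP.<-≤-trans (ℚn-pos 1) (ℚn-mono-≤ (i<0⇒0<∣i∣ Nα<0))

  C≤proj₂[α*η²] : ∀ p r → υ * υ ≤ r * r → C ≤ proj₂ (mulD d α (sqD d (p , r)))
  C≤proj₂[α*η²] p r υ²≤r² = ℚP.*-cancelˡ-≤-pos B {{ℚ.positive 0<B}} (begin
    B * C
      ≡⟨ B*C≡M*υ² ⟩
    M * (υ * υ)
      ≤⟨ ℚP.*-monoˡ-≤-nonNeg M {{ℚ.nonNegative 0≤M}} υ²≤r² ⟩
    M * (r * r)
      ≤⟨ p≤p+q (M * (r * r)) (0≤p*p (B * p + A * r)) ⟩
    M * (r * r) + (B * p + A * r) * (B * p + A * r)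
      ≡⟨ cong (λ m → m * (r * r) + (B * p + A * r) * (B * p + A * r)) M≡D*B*B-A*A ⟩
    (D * B * B - A * A) * (r * r) + (B * p + A * r) * (B * p + A * r)
      ≡⟨ proj₂-mulD-sq d A B p r ⟨
    B * proj₂ (mulD d α (sqD d (p , r)))
      ∎)
    where open ℚP.≤-Reasoning

  C≤y : ∀ k → k ≢ 0ℤ → C ≤ y k
  C≤y (+ zero)  k≢0 = ⊥-elim (k≢0 refl)
  C≤y (+ suc m) _   = subst (C ≤_) (sym (cong proj₂ (orbit-forward (suc m))))
    (C≤proj₂[α*η²] (proj₁ (powD d ε (suc m))) (proj₂ (powD d ε (suc m))) (υ²≤proj₂[εᵐ⁺¹]² m))
  C≤y -[1+ m ]  _   = subst (C ≤_) (sym (cong proj₂ (orbit-backward (suc m))))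
    (C≤proj₂[α*η²] (proj₁ (powD d (conjD ε) (suc m))) (proj₂ (powD d (conjD ε) (suc m))) (υ²≤proj₂[ε̄ᵐ⁺¹]² m))

  y₀≡B : y 0ℤ ≡ B
  y₀≡B = cong proj₂ xy₀

  0<y : ∀ k → 0ℚ < y k
  0<y (+ zero)     = subst (0ℚ <_) (sym y₀≡B) 0<B
  0<y k@(+ suc _)  = ℚP.<-≤-trans 0<C (C≤y k λ ())
  0<y k@(-[1+ _ ]) = ℚP.<-≤-trans 0<C (C≤y k λ ())

  2*y₁≡B*T+A*t*u : ℚn 2 * y 1ℤ ≡ B * T + A * (ℚn t * ℚn u)
  2*y₁≡B*T+A*t*u = begin
    ℚn 2 * y 1ℤ                                         ≡⟨ cong (λ v → ℚn 2 * proj₂ v) (step 0ℤ) ⟩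
    ℚn 2 * proj₂ (mulD d (xy 0ℤ) (sqD d ε))             ≡⟨ cong (λ v → ℚn 2 * proj₂ (mulD d v (sqD d ε))) xy₀ ⟩
    ℚn 2 * (A * proj₂ (sqD d ε) + B * proj₁ (sqD d ε))  ≡⟨ double A B (proj₁ (sqD d ε)) (proj₂ (sqD d ε)) ⟩
    B * T + A * (ℚn 2 * proj₂ (sqD d ε))                ≡⟨ cong (λ v → B * T + A * v) 2*proj₂[ε²]≡t*u ⟩
    B * T + A * (ℚn t * ℚn u)                           ∎
    where
    open ≡-Reasoning
    double : ∀ A B P Q → ℚn 2 * (A * Q + B * P) ≡ B * (P + P) + A * (ℚn 2 * Q)
    double = solve-∀ ℚ-ring

  y₀<y₁ : y 0ℤ < y 1ℤ
  y₀<y₁ = ℚP.*-cancelˡ-<-nonNeg (ℚn 2) (begin-strict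
    ℚn 2 * y 0ℤ                ≡⟨ cong (ℚn 2 *_) y₀≡B ⟩
    ℚn 2 * B                   ≡⟨ ℚP.*-comm (ℚn 2) B ⟩
    B * ℚn 2                   ≤⟨ ℚP.*-monoˡ-≤-nonNeg B {{ℚ.nonNegative (ℚP.<⇒≤ 0<B)}} 2≤T ⟩
    B * T                      <⟨ p<p+q (B * T) (0<p*q (ℚn-pos a) (0<p*q (ℚn-pos t) (ℚn-pos u))) ⟩
    B * T + A * (ℚn t * ℚn u)  ≡⟨ 2*y₁≡B*T+A*t*u ⟨
    ℚn 2 * y 1ℤ                ∎)
    where open ℚP.≤-Reasoning

  2y-positive-integer : ∀ k → ∃[ n ] (0 ℕ.< n × ℚn 2 * y k ≡ ℚn n)
  2y-positive-integer k = integral-pos⇒ℚn (∫2y k) (0<p*q (ℚn-pos 2) (0<y k))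
    where
    ∫2y₀ : Integral (ℚn 2 * y 0ℤ)
    ∫2y₀ = subst Integral (cong (ℚn 2 *_) (sym y₀≡B)) (integral-* (integral-ℚn 2) (integral-ℚn (b ℕ.* b)))
    ∫2y₁ : Integral (ℚn 2 * y 1ℤ)
    ∫2y₁ = subst Integral (sym 2*y₁≡B*T+A*t*u)
             (integral-+ (integral-* (integral-ℚn (b ℕ.* b)) integral-T)
                         (integral-* (integral-ℚn a) (integral-* (integral-ℚn t) (integral-ℚn u))))
    ∫2y : ∀ k → Integral (ℚn 2 * y k)
    ∫2y = integral-recurrentℤ {T} {λ k → ℚn 2 * y k} (recurrentℤ-scale {T} {y} y-recurrent (ℚn 2))
            integral-T ∫2y₀ ∫2y₁

  module Forward = IncreasingRecurrence {T} {λ m → y (+ m)} 2≤T (recurrent-forward {T} {y} y-recurrent 0ℤ)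
                                        (ℚP.<⇒≤ (0<y 0ℤ)) y₀<y₁

  y-increasing : ∀ k → 0ℤ ℤ.≤ k → 0ℚ < y k × y k < y (k ℤ.+ 1ℤ)
  y-increasing (+ m) _ = 0<y (+ m) , subst (λ j → y (+ m) < y j) (n+[1+m]≡n+m+1 0ℤ m) (Forward.increasing m)

  y[K+1]<y[K] : ∀ K → K ℤ.< 0ℤ → B < y K → (∀ k → K ℤ.< k → k ℤ.< 0ℤ → y k ≤ B) → y (K ℤ.+ 1ℤ) < y K
  y[K+1]<y[K] -[1+ zero ]  _ B<y[K] _   = subst (_< y -[1+ 0 ]) (sym y₀≡B) B<y[K]
  y[K+1]<y[K] -[1+ suc n ] _ B<y[K] y≤B = ℚP.≤-<-trans (y≤B -[1+ n ] (ℤ.-<- ℕP.≤-refl) ℤ.-<+) B<y[K]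
  y[K+1]<y[K] (+ n)        (ℤ.+<+ ())

  module NegativeIndices (K : ℤ) (K<0 : K ℤ.< 0ℤ) (B<y[K] : B < y K)
                         (y≤B : ∀ k → K ℤ.< k → k ℤ.< 0ℤ → y k ≤ B) where

    private
      K+1-0≡K+1 : K ℤ.+ 1ℤ ℤ.- + 0 ≡ K ℤ.+ 1ℤ
      K+1-0≡K+1 = ℤP.+-identityʳ (K ℤ.+ 1ℤ)

    module Backward = IncreasingRecurrence {T} {λ m → y (K ℤ.+ 1ℤ ℤ.- + m)} 2≤T
                        (recurrent-backward {T} {y} y-recurrent (K ℤ.+ 1ℤ))
                        (subst (λ j → 0ℚ ≤ y j) (sym K+1-0≡K+1) (ℚP.<⇒≤ (0<y (K ℤ.+ 1ℤ))))
                        (subst₂ (λ i j → y i < y j) (sym K+1-0≡K+1) (sym (i+1-1≡i K))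
                          (y[K+1]<y[K] K K<0 B<y[K] y≤B))

    y-decreasing : ∀ k → k ℤ.≤ K ℤ.+ 1ℤ → 0ℚ < y k × y k < y (k ℤ.- 1ℤ)
    y-decreasing k k≤K+1 = 0<y k , subst₂ (λ i j → y i < y j) (sym k≡) (sym k-1≡) (Backward.increasing m)
      where
      m : ℕ
      m = ℤ.∣ K ℤ.+ 1ℤ ℤ.- k ∣
      k≡ : k ≡ K ℤ.+ 1ℤ ℤ.- + m
      k≡ = k≤n⇒k≡n-∣n-k∣ k≤K+1
      k-1≡ : k ℤ.- 1ℤ ≡ K ℤ.+ 1ℤ ℤ.- + suc m
      k-1≡ = trans (cong (ℤ._- 1ℤ) k≡) (sym (n-[1+m]≡n-m-1 (K ℤ.+ 1ℤ) m))

    lower-bounds : ∀ {r} → AdmissibleRatio r → LowerBounds C r K y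
    lower-bounds {r} (0≤r , r≤T-1) = positive , negative
      where
      positive : ∀ k → 0ℤ ℤ.< k → C * (r ^ℚ ℤ.∣ k ℤ.- 1ℤ ∣) ≤ y k
      positive (+ suc m) _ = Forward.geometric-lower-bound 0≤r r≤T-1 (C≤y 1ℤ λ ()) m
      positive (+ zero) (ℤ.+<+ ())

      C≤y[K] : C ≤ y (K ℤ.+ 1ℤ ℤ.- + 1)
      C≤y[K] = subst (λ j → C ≤ y j) (sym (i+1-1≡i K)) (C≤y K (ℤP.<⇒≢ K<0))

      negative : ∀ k → k ℤ.< 0ℤ → C * (r ^ℚ ℤ.∣ (K ℤ.- k) ℤ.⊔ 0ℤ ∣) ≤ y k
      negative k k<0 = by-cases (K ℤ.- k) refl
        where
        C*1≤y[k] : C * 1ℚ ≤ y k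
        C*1≤y[k] = subst (_≤ y k) (sym (ℚP.*-identityʳ C)) (C≤y k (ℤP.<⇒≢ k<0))
        by-cases : ∀ j → K ℤ.- k ≡ j → C * (r ^ℚ ℤ.∣ j ℤ.⊔ 0ℤ ∣) ≤ y k
        by-cases (+ zero)  _     = C*1≤y[k]
        by-cases -[1+ _ ]  _     = C*1≤y[k]
        by-cases (+ suc n) K-k≡j = subst (λ i → C * (r ^ℚ suc n) ≤ y i) index
                                     (Backward.geometric-lower-bound 0≤r r≤T-1 C≤y[K] (suc n))
          where
          open ≡-Reasoning
          shift : ∀ K j → K ℤ.+ 1ℤ ℤ.- (1ℤ ℤ.+ (1ℤ ℤ.+ j)) ≡ K ℤ.- (1ℤ ℤ.+ j)
          shift = ℤ-Solver.solve-∀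
          cancel : ∀ K k → K ℤ.- (K ℤ.- k) ≡ k
          cancel = ℤ-Solver.solve-∀
          index : K ℤ.+ 1ℤ ℤ.- + suc (suc n) ≡ k
          index = begin
            K ℤ.+ 1ℤ ℤ.- + suc (suc n)  ≡⟨ shift K (+ n) ⟩
            K ℤ.- + suc n               ≡⟨ cong (λ j → K ℤ.- j) K-k≡j ⟨
            K ℤ.- (K ℤ.- k)             ≡⟨ cancel K k ⟩
            k                           ∎

lemma3p2 : (a b d t u : ℕ) → .{{_ : NonZero a}} → .{{_ : NonZero b}} → .{{_ : NonZero d}} →
    .{{_ : NonZero t}} → .{{_ : NonZero u}} →
    (∀ (m : ℕ) → m ℕ.* m ≢ d) →
    Nalpha a b d ℤ.< 0ℤ →
    (normEps d t u ≡ 1ℚ ⊎ normEps d t u ≡ ℚ.- 1ℚ) →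
    (x y : ℤ → ℚ) →
    (x 0ℤ , y 0ℤ) ≡ (ℚn a , ℚn (b ℕ.* b)) →
    (∀ k → (x (k ℤ.+ 1ℤ) , y (k ℤ.+ 1ℤ)) ≡ mulD d (x k , y k) (mulD d (epsD t u) (epsD t u))) →
    (∀ k → IsSquareℚ (y k) → ℚn (b ℕ.* b) ℚ.≤ y k) →
    (K : ℤ) → K ℤ.< 0ℤ → ℚn (b ℕ.* b) ℚ.< y K →
    (∀ k → K ℤ.< k → k ℤ.< 0ℤ → y k ℚ.≤ ℚn (b ℕ.* b)) →
    ((∀ k → ∃[ n ] (0 ℕ.< n × ℚn 2 ℚ.* y k ≡ ℚn n)) ×
     (∀ k → 0ℤ ℤ.≤ k → ℚ.0ℚ ℚ.< y k × y k ℚ.< y (k ℤ.+ 1ℤ)) ×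
     (∀ k → k ℤ.≤ K ℤ.+ 1ℤ → ℚ.0ℚ ℚ.< y k × y k ℚ.< y (k ℤ.- 1ℤ))) ×
    LowerBounds (coef a b d u) (ℚn (d ℕ.* u ℕ.* u) ℚ.- ℚn 3) K y ×
    ((normEps d t u ≡ 1ℚ ⊎ 300 ℕ.≤ d ℕ.* u ℕ.* u) →
      LowerBounds (coef a b d u) ((+ 99 / 100) ℚ.* ℚn (d ℕ.* u ℕ.* u)) K y) ×
    LowerBounds (coef a b d u) ((+ 4 / 10) ℚ.* ℚn (d ℕ.* u ℕ.* u)) K y
lemma3p2 a b d t u _ Nα<0 norm±1 x y xy₀ step _ K K<0 B<y[K] y≤B =
  (2y-positive-integer , y-increasing , y-decreasing) ,
  lower-bounds admissible-du²-3 ,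
  lower-bounds ∘ admissible-0·99du² ,
  lower-bounds admissible-0·4du²
  where
  -- The non-squareness of d and the minimality of the square y₀ = b² are what single out K in
  -- the paper; here K comes with its defining properties, so those two hypotheses are unused.
  open Orbit a b d t u norm±1 Nα<0 x y xy₀ step
  open NegativeIndices K K<0 B<y[K] y≤B
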